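{- Let $l$ and $t$ be positive integers. Then for every $n$ there is a collection of pairwise vertex-disjoint subgraphs of $Q_n$, each isomorphic to a graph of the form $H_1\times\cdots\times H_t$ with every $H_i$ a graph on $l$ vertices having a Hamilton path, that covers all but at most $O(n^{t-1})$ vertices of $Q_n$ (the implied constant depending only on $l$ and $t$).
   Context: $Q_n$ is the $n$-dimensional hypercube on $\{0,1\}^n$. For graphs $G_1,G_2$ the Cartesian product $G_1\times G_2$ has vertex set $V(G_1)\times V(G_2)$, with $(u_1,u_2)\sim(v_1,v_2)$ iff either $u_1=v_1$ and $u_2v_2\in E(G_2)$, or $u_2=v_2$ and $u_1v_1\in E(G_1)$. The subgraphs need not be induced. -}

module Defs where

open import Data.Nat using (ℕ; suc; _<_; _≤_; _*_; _^_; _∸_)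
open import Data.Nat.Properties using (<-trans; n<1+n)
open import Data.Bool using (Bool; true)
open import Data.Fin using (Fin; fromℕ<)
open import Data.Vec using (Vec; lookup)
open import Data.List using (List; length)
import Data.List as L
open import Data.Product using (Σ; _×_)
open import Data.Sum using (_⊎_)
open import Data.Empty using (⊥)
open import Relation.Binary.PropositionalEquality using (_≡_; _≢_)
open import Function.Definitions using (Injective)
open import Data.List.Membership.Propositional using (_∈_)

QVertex : ℕ → Set
QVertex n = Vec Bool n

QAdj : ∀ {n} → QVertex n → QVertex n → Set
QAdj {n} u v = Σ (Fin n) λ j →
  (lookup u j ≢ lookup v j) × (∀ k → k ≢ j → lookup u k ≡ lookup v k)

record Graph (l : ℕ) : Set where
  field
    adj     : Fin l → Fin l → Bool
    adj-sym : ∀ x y → adj x y ≡ adj y x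
    irrefl  : ∀ x → adj x x ≡ true → ⊥

-- A Hamilton path: an ordering p(0), …, p(l-1) of all vertices (p injective,
-- hence a bijection of Fin l) with consecutive vertices adjacent.
HasHamPath : ∀ {l} → Graph l → Set
HasHamPath {l} G = Σ (Fin l → Fin l) λ p → Injective _≡_ _≡_ p ×
  (∀ (i : ℕ) (h : suc i < l) →
     Graph.adj G (p (fromℕ< (<-trans (n<1+n i) h))) (p (fromℕ< h)) ≡ true)

ProdAdj : ∀ {l t} → Vec (Graph l) t → Vec (Fin l) t → Vec (Fin l) t → Set
ProdAdj {l} {t} Hs x y = Σ (Fin t) λ j →
  (Graph.adj (lookup Hs j) (lookup x j) (lookup y j) ≡ true) ×
  (∀ k → k ≢ j → lookup x k ≡ lookup y k)

-- A (not necessarily induced) subgraph of Q_n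
-- isomorphic to G is the same as an injective homomorphism G → Q_n
-- (its image with the image edges).
record Piece (n l t : ℕ) : Set where
  field
    factors : Vec (Graph l) t
    ham     : ∀ j → HasHamPath (lookup factors j)
    emb     : Vec (Fin l) t → QVertex n
    emb-inj : Injective _≡_ _≡_ emb
    emb-hom : ∀ x y → ProdAdj factors x y → QAdj (emb x) (emb y)

PairwiseDisjoint : ∀ {n l t} → List (Piece n l t) → Set
PairwiseDisjoint ps = ∀ (i j : Fin (length ps)) → i ≢ j →
  ∀ x y → Piece.emb (L.lookup ps i) x ≢ Piece.emb (L.lookup ps j) y

Covered : ∀ {n l t} → List (Piece n l t) → QVertex n → Set
Covered ps v = Σ (Fin (length ps)) λ i → Σ _ λ x → Piece.emb (L.lookup ps i) x ≡ v

CoversAllBut : ∀ {n l t} → List (Piece n l t) → ℕ → Set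
CoversAllBut {n} ps b = Σ (List (QVertex n)) λ U → (length U ≤ b) ×
  (∀ v → Covered ps v ⊎ v ∈ U)

module Submission where

-- Induction on the dimension t of the grids P_l^t, each a product of paths (which have Hamilton
-- paths).  Suppose every Q_m is tiled by copies of P_l^s up to f(m) vertices.  Then Q_m × P_r,
-- r < 2l, is tiled by P_l^(s+1) by induction on m: Q_(m+1) × P_r ≅ Q_m × P_2r by snaking the path
-- through both halves of Q_(m+1), and once the path has at least l vertices a factor P_l splits
-- off, with Q_m × P_l tiled from the tiling of Q_m at a loss of l·f(m) vertices.  Unrolling loses at
-- most l + l(m+1)f(m) vertices of Q_m = Q_m × P_1, so the loss is O(m^s) for grids of dimension s+1.

open import Defs
open import Data.Nat using (ℕ; zero; suc; pred; _+_; _*_; _^_; _∸_; _≤_; _<_; _<?_; _≡ᵇ_; z≤n; s≤s)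
open import Data.Nat.Properties
open import Data.Nat.Solver using (module +-*-Solver)
open import Data.Bool using (Bool; true; false; _∨_)
open import Data.Bool.Properties using (∨-comm; T-≡; T-∨)
open import Data.Fin using (Fin; zero; suc; toℕ; splitAt; join; _↑ˡ_; _↑ʳ_; opposite; remQuot; combine; cast)
open import Data.Fin.Properties
  using (toℕ-↑ˡ; toℕ-↑ʳ; toℕ<n; toℕ-injective; toℕ-fromℕ<; toℕ-cast; cast-involutive; splitAt-↑ˡ; splitAt-↑ʳ;
         splitAt⁻¹-↑ˡ; splitAt⁻¹-↑ʳ; join-splitAt; opposite-prop; opposite-involutive; remQuot-combine; *↔×; 2↔Bool)
import Data.Fin.Properties as Fin
open import Data.Vec using (Vec; []; _∷_; lookup; replicate)
open import Data.Vec.Properties using (lookup-replicate; tabulate∘lookup; tabulate-cong)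
open import Data.List using (List; length; tabulate)
import Data.List as List
open import Data.List.Properties using (length-tabulate; lookup-tabulate)
open import Data.List.Membership.Propositional using (_∈_)
open import Data.List.Membership.Propositional.Properties using (∈-tabulate⁺)
open import Data.Product using (Σ; _×_; _,_; proj₁; proj₂; uncurry)
import Data.Product as Product
open import Data.Product.Function.NonDependent.Propositional using (_×-↔_)
open import Data.Sum using (_⊎_; inj₁; inj₂; [_,_]; [_,_]′)
import Data.Sum as Sum
open import Data.Sum.Properties using (inj₁-injective)
open import Data.Sum.Relation.Binary.Pointwise using (Pointwise; inj₁; inj₂)
open import Data.Empty using (⊥-elim)
open import Relation.Nullary using (yes; no)
open import Function using (id; _∘_; _↔_; Inverse; mk↔ₛ′; Equivalence)
open import Function.Properties.Inverse using (↔-trans)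
open import Relation.Binary.PropositionalEquality
  using (_≡_; _≢_; ≢-sym; refl; sym; trans; cong; subst; subst₂; module ≡-Reasoning)

PathAdj : ∀ {r} → Fin r → Fin r → Set
PathAdj i j = suc (toℕ i) ≡ toℕ j ⊎ suc (toℕ j) ≡ toℕ i

PathAdj-↑ˡ : ∀ {m} n {i j : Fin m} → PathAdj i j → PathAdj (i ↑ˡ n) (j ↑ˡ n)
PathAdj-↑ˡ n = Sum.map shift shift
  where
    shift : ∀ {a b} → suc (toℕ a) ≡ toℕ b → suc (toℕ (a ↑ˡ n)) ≡ toℕ (b ↑ˡ n)
    shift {a} {b} e = trans (cong suc (toℕ-↑ˡ a n)) (trans e (sym (toℕ-↑ˡ b n)))

PathAdj-↑ʳ : ∀ {m} n {i j : Fin m} → PathAdj i j → PathAdj (n ↑ʳ i) (n ↑ʳ j)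
PathAdj-↑ʳ n = Sum.map shift shift
  where
    shift : ∀ {a b} → suc (toℕ a) ≡ toℕ b → suc (toℕ (n ↑ʳ a)) ≡ toℕ (n ↑ʳ b)
    shift {a} {b} e = begin
      suc (toℕ (n ↑ʳ a)) ≡⟨ cong suc (toℕ-↑ʳ n a) ⟩
      suc (n + toℕ a)    ≡⟨ sym (+-suc n (toℕ a)) ⟩
      n + suc (toℕ a)    ≡⟨ cong (n +_) e ⟩
      n + toℕ b          ≡⟨ sym (toℕ-↑ʳ n b) ⟩
      toℕ (n ↑ʳ b)       ∎
      where open ≡-Reasoning

Grid : ℕ → ℕ → Set
Grid l t = Vec (Fin l) t

data GridAdj {l} : ∀ {t} → Grid l t → Grid l t → Set where
  here  : ∀ {t x y} {xs : Grid l t} → PathAdj x y → GridAdj (x ∷ xs) (y ∷ xs)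
  there : ∀ {t x} {xs ys : Grid l t} → GridAdj xs ys → GridAdj (x ∷ xs) (x ∷ ys)

CartesianPath : ∀ {V : Set} {r} → (V → V → Set) → V × Fin r → V × Fin r → Set
CartesianPath _∼_ (v , i) (w , j) = (v ∼ w × i ≡ j) ⊎ (v ≡ w × PathAdj i j)

CartesianPath-sym : ∀ {V : Set} {_∼_ : V → V → Set} {r} → (∀ {v w} → v ∼ w → w ∼ v) →
                    ∀ {x y : V × Fin r} → CartesianPath _∼_ x y → CartesianPath _∼_ y x
CartesianPath-sym ∼-sym {_ , _} {_ , _} (inj₁ (v∼w , refl)) = inj₁ (∼-sym v∼w , refl)
CartesianPath-sym ∼-sym {_ , _} {_ , _} (inj₂ (refl , p))   = inj₂ (refl , Sum.swap p)

-- A vertex-disjoint packing of copies of the grid P_l^t into (V, ∼) missing at most b vertices: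
-- locate is left inverse to the copies (so they are injective and pairwise disjoint) and the
-- copies together with the leftovers exhaust V.
record GridTiling (l t : ℕ) (V : Set) (_∼_ : V → V → Set) (b : ℕ) : Set where
  field
    copies leftovers : ℕ
    leftovers≤       : leftovers ≤ b
    copy             : Fin copies → Grid l t → V
    leftover         : Fin leftovers → V
    locate           : V → (Fin copies × Grid l t) ⊎ Fin leftovers
    locate-copy      : ∀ i x → locate (copy i x) ≡ inj₁ (i , x)
    place-locate     : ∀ v → [ uncurry copy , leftover ]′ (locate v) ≡ v
    copy-hom         : ∀ i {x y} → GridAdj x y → copy i x ∼ copy i y

  copy-injective : ∀ {i j x y} → copy i x ≡ copy j y → (i , x) ≡ (j , y)
  copy-injective {i} {j} {x} {y} e =
    inj₁-injective (trans (sym (locate-copy i x)) (trans (cong locate e) (locate-copy j y)))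

module _ {l t : ℕ} {V : Set} where

  weaken : ∀ {_∼_ b b′} → b ≤ b′ → GridTiling l t V _∼_ b → GridTiling l t V _∼_ b′
  weaken b≤b′ T = record
    { copies = copies ; leftovers = leftovers ; leftovers≤ = ≤-trans leftovers≤ b≤b′
    ; copy = copy ; leftover = leftover ; locate = locate
    ; locate-copy = locate-copy ; place-locate = place-locate ; copy-hom = copy-hom
    }
    where open GridTiling T

  transfer : ∀ {W : Set} {_∼_ _≈_ b} (e : V ↔ W) → (∀ {x y} → x ∼ y → Inverse.to e x ≈ Inverse.to e y) →
             GridTiling l t V _∼_ b → GridTiling l t W _≈_ b
  transfer e hom T = record
    { copies       = copies
    ; leftovers    = leftovers
    ; leftovers≤   = leftovers≤
    ; copy         = λ i → to ∘ copy i
    ; leftover     = to ∘ leftover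
    ; locate       = locate ∘ from
    ; locate-copy  = λ i x → trans (cong locate (strictlyInverseʳ (copy i x))) (locate-copy i x)
    ; place-locate = λ w → trans (place-to (locate (from w)))
                                 (trans (cong to (place-locate (from w))) (strictlyInverseˡ w))
    ; copy-hom     = λ i → hom ∘ copy-hom i
    }
    where
      open GridTiling T
      open Inverse e
      place-to : ∀ s → [ uncurry (λ i → to ∘ copy i) , to ∘ leftover ]′ s ≡ to ([ uncurry copy , leftover ]′ s)
      place-to = [ (λ _ → refl) , (λ _ → refl) ]

  allLeftovers : ∀ {_∼_ r} → Fin r ↔ V → GridTiling l t V _∼_ r
  allLeftovers e = record
    { copies = 0 ; leftovers = _ ; leftovers≤ = ≤-refl
    ; copy = λ () ; leftover = to ; locate = inj₂ ∘ from
    ; locate-copy = λ () ; place-locate = strictlyInverseˡ ; copy-hom = λ ()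
    }
    where open Inverse e

  _⊎-tiling_ : ∀ {W : Set} {_∼₁_ _∼₂_ b₁ b₂} → GridTiling l t V _∼₁_ b₁ → GridTiling l t W _∼₂_ b₂ →
               GridTiling l t (V ⊎ W) (Pointwise _∼₁_ _∼₂_) (b₁ + b₂)
  _⊎-tiling_ {W} {_∼₁_} {_∼₂_} T₁ T₂ = record
    { copies = k₁ + k₂ ; leftovers = u₁ + u₂ ; leftovers≤ = +-mono-≤ T₁.leftovers≤ T₂.leftovers≤
    ; copy = copy ; leftover = leftover ; locate = locate
    ; locate-copy = locate-copy ; place-locate = place-locate ; copy-hom = copy-hom
    }
    where
      module T₁ = GridTiling T₁
      module T₂ = GridTiling T₂
      k₁ = T₁.copies
      k₂ = T₂.copies
      u₁ = T₁.leftovers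
      u₂ = T₂.leftovers

      copy : Fin (k₁ + k₂) → Grid l t → V ⊎ W
      copy i x = Sum.map (λ i₁ → T₁.copy i₁ x) (λ i₂ → T₂.copy i₂ x) (splitAt k₁ i)

      leftover : Fin (u₁ + u₂) → V ⊎ W
      leftover = Sum.map T₁.leftover T₂.leftover ∘ splitAt u₁

      place : (Fin (k₁ + k₂) × Grid l t) ⊎ Fin (u₁ + u₂) → V ⊎ W
      place = [ uncurry copy , leftover ]′

      locate : V ⊎ W → (Fin (k₁ + k₂) × Grid l t) ⊎ Fin (u₁ + u₂)
      locate = [ Sum.map (Product.map₁ (_↑ˡ k₂)) (_↑ˡ u₂) ∘ T₁.locate
               , Sum.map (Product.map₁ (k₁ ↑ʳ_)) (u₁ ↑ʳ_) ∘ T₂.locate ]′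

      locate-copy : ∀ i x → locate (copy i x) ≡ inj₁ (i , x)
      locate-copy i x with splitAt k₁ i in eq
      ... | inj₁ i₁ rewrite T₁.locate-copy i₁ x = cong (λ j → inj₁ (j , x)) (splitAt⁻¹-↑ˡ eq)
      ... | inj₂ i₂ rewrite T₂.locate-copy i₂ x = cong (λ j → inj₁ (j , x)) (splitAt⁻¹-↑ʳ eq)

      place-locate : ∀ v → place (locate v) ≡ v
      place-locate (inj₁ v) with T₁.locate v | T₁.place-locate v
      ... | inj₁ (i , x) | e rewrite splitAt-↑ˡ k₁ i k₂ = cong inj₁ e
      ... | inj₂ a       | e rewrite splitAt-↑ˡ u₁ a u₂ = cong inj₁ e
      place-locate (inj₂ w) with T₂.locate w | T₂.place-locate w
      ... | inj₁ (i , x) | e rewrite splitAt-↑ʳ k₁ k₂ i = cong inj₂ e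
      ... | inj₂ a       | e rewrite splitAt-↑ʳ u₁ u₂ a = cong inj₂ e

      copy-hom : ∀ i {x y} → GridAdj x y → Pointwise _∼₁_ _∼₂_ (copy i x) (copy i y)
      copy-hom i a with splitAt k₁ i
      ... | inj₁ i₁ = inj₁ (T₁.copy-hom i₁ a)
      ... | inj₂ i₂ = inj₂ (T₂.copy-hom i₂ a)

  ×-path-tiling : ∀ {_∼_ b} → GridTiling l t V _∼_ b →
                  GridTiling l (suc t) (V × Fin l) (CartesianPath _∼_) (b * l)
  ×-path-tiling {_∼_} T = record
    { copies = copies ; leftovers = leftovers * l ; leftovers≤ = *-monoˡ-≤ l leftovers≤
    ; copy = copy′ ; leftover = leftover′ ; locate = locate′
    ; locate-copy = locate-copy′ ; place-locate = place-locate′ ; copy-hom = copy-hom′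
    }
    where
      open GridTiling T

      copy′ : Fin copies → Grid l (suc t) → V × Fin l
      copy′ i (x ∷ xs) = copy i xs , x

      leftover′ : Fin (leftovers * l) → V × Fin l
      leftover′ = Product.map₁ leftover ∘ remQuot l

      locate′ : V × Fin l → (Fin copies × Grid l (suc t)) ⊎ Fin (leftovers * l)
      locate′ (v , x) = Sum.map (Product.map₂ (x ∷_)) (λ a → combine a x) (locate v)

      locate-copy′ : ∀ i x → locate′ (copy′ i x) ≡ inj₁ (i , x)
      locate-copy′ i (x ∷ xs) rewrite locate-copy i xs = refl

      place-locate′ : ∀ v → [ uncurry copy′ , leftover′ ]′ (locate′ v) ≡ v
      place-locate′ (v , x) with locate v | place-locate v
      ... | inj₁ (i , xs) | e = cong (_, x) e
      ... | inj₂ a        | e = trans (cong (Product.map₁ leftover) (remQuot-combine a x)) (cong (_, x) e)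

      copy-hom′ : ∀ i {x y} → GridAdj x y → CartesianPath _∼_ (copy′ i x) (copy′ i y)
      copy-hom′ i (here p)  = inj₂ (refl , p)
      copy-hom′ i (there a) = inj₁ (copy-hom i a , refl)

pointTiling : ∀ {l k V _∼_} → Fin k ↔ V → GridTiling l 0 V _∼_ 0
pointTiling e = record
  { copies = _ ; leftovers = 0 ; leftovers≤ = z≤n
  ; copy = λ i _ → to i ; leftover = λ () ; locate = λ v → inj₁ (from v , [])
  ; locate-copy = λ { i [] → cong (λ j → inj₁ (j , [])) (strictlyInverseʳ i) }
  ; place-locate = strictlyInverseˡ ; copy-hom = λ _ ()
  }
  where open Inverse e

QAdj-∷ : ∀ {m} b {u v : QVertex m} → QAdj u v → QAdj (b ∷ u) (b ∷ v)
QAdj-∷ b (j , u≢v , agree) = suc j , u≢v , λ { zero _ → refl ; (suc k) k≢j → agree k (k≢j ∘ cong suc) }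

QAdj-head : ∀ {m b b′} (v : QVertex m) → b ≢ b′ → QAdj (b ∷ v) (b′ ∷ v)
QAdj-head v b≢b′ = zero , b≢b′ , λ { zero 0≢0 → ⊥-elim (0≢0 refl) ; (suc k) _ → refl }

cube↔ : ∀ m → Fin (2 ^ m) ↔ QVertex m
cube↔ zero    = mk↔ₛ′ (λ _ → []) (λ _ → zero) (λ { [] → refl }) (λ { zero → refl })
cube↔ (suc m) = ↔-trans *↔× (↔-trans (2↔Bool ×-↔ cube↔ m) cons↔)
  where
    cons↔ : (Bool × QVertex m) ↔ QVertex (suc m)
    cons↔ = mk↔ₛ′ (uncurry _∷_) (λ { (b ∷ v) → b , v }) (λ { (_ ∷ _) → refl }) (λ _ → refl)

m<n∧1+m≡n+o⇒m≡n∸[1+o] : ∀ {m n} o → m < n → suc m ≡ n + o → m ≡ n ∸ suc o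
m<n∧1+m≡n+o⇒m≡n∸[1+o] {n = n} zero    _   e = trans (cong pred (trans e (+-identityʳ n))) (pred[m∸n]≡m∸[1+n] n 0)
m<n∧1+m≡n+o⇒m≡n∸[1+o] {n = n} (suc o) m<n e = ⊥-elim (m+n≮m n o (subst (_≤ n) (trans e (+-suc n o)) m<n))

opposite-reverses-step : ∀ {r} (b b′ : Fin r) → suc (toℕ b) ≡ toℕ b′ → suc (toℕ (opposite b′)) ≡ toℕ (opposite b)
opposite-reverses-step {r} b b′ e = begin
  suc (toℕ (opposite b′))  ≡⟨ cong suc (opposite-prop b′) ⟩
  suc (r ∸ suc (toℕ b′))   ≡⟨ sym (+-∸-assoc 1 (toℕ<n b′)) ⟩
  r ∸ toℕ b′               ≡⟨ cong (r ∸_) (sym e) ⟩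
  r ∸ suc (toℕ b)          ≡⟨ sym (opposite-prop b) ⟩
  toℕ (opposite b)         ∎
  where open ≡-Reasoning

module _ {r : ℕ} where

  -- Fin (r + r) runs along the ladder Q_1 × P_r as a snake: out along the rung false, back along true.
  rung : Fin r ⊎ Fin r → Bool × Fin r
  rung = [ (false ,_) , (true ,_) ∘ opposite ]′

  ladder : Fin (r + r) → Bool × Fin r
  ladder i = rung (splitAt r i)

  unladder : Bool × Fin r → Fin (r + r)
  unladder (false , a) = a ↑ˡ r
  unladder (true  , a) = r ↑ʳ opposite a

  ladder↔ : Fin (r + r) ↔ (Bool × Fin r)
  ladder↔ = mk↔ₛ′ ladder unladder ladder-unladder unladder-ladder
    where
      ladder-unladder : ∀ x → ladder (unladder x) ≡ x
      ladder-unladder (false , a) rewrite splitAt-↑ˡ r a r = refl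
      ladder-unladder (true  , a) rewrite splitAt-↑ʳ r r (opposite a) | opposite-involutive a = refl

      unladder-ladder : ∀ i → unladder (ladder i) ≡ i
      unladder-ladder i with splitAt r i in eq
      ... | inj₁ a = splitAt⁻¹-↑ˡ eq
      ... | inj₂ b = trans (cong (r ↑ʳ_) (opposite-involutive b)) (splitAt⁻¹-↑ʳ eq)

  ladder-step : ∀ {i j : Fin (r + r)} → suc (toℕ i) ≡ toℕ j → CartesianPath _≢_ (ladder i) (ladder j)
  ladder-step {i} {j} e =
    rung-step (splitAt r i) (splitAt r j)
      (subst₂ (λ i′ j′ → suc (toℕ i′) ≡ toℕ j′) (sym (join-splitAt r r i)) (sym (join-splitAt r r j)) e)
    where
      rung-step : ∀ s s′ → suc (toℕ (join r r s)) ≡ toℕ (join r r s′) → CartesianPath _≢_ (rung s) (rung s′)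
      rung-step (inj₁ a) (inj₁ a′) e rewrite toℕ-↑ˡ a r | toℕ-↑ˡ a′ r = inj₂ (refl , inj₁ e)
      rung-step (inj₁ a) (inj₂ b)  e rewrite toℕ-↑ˡ a r | toℕ-↑ʳ r b =
        inj₁ ((λ ()) , toℕ-injective (trans (m<n∧1+m≡n+o⇒m≡n∸[1+o] (toℕ b) (toℕ<n a) e) (sym (opposite-prop b))))
      rung-step (inj₂ b) (inj₁ a′) e rewrite toℕ-↑ʳ r b | toℕ-↑ˡ a′ r =
        ⊥-elim (m+n≮m r (toℕ b) (<-trans (≤-reflexive e) (toℕ<n a′)))
      rung-step (inj₂ b) (inj₂ b′) e rewrite toℕ-↑ʳ r b | toℕ-↑ʳ r b′ =
        inj₂ (refl , inj₂ (opposite-reverses-step b b′ (+-cancelˡ-≡ r _ _ (trans (+-suc r (toℕ b)) e))))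

  ladder-adj : ∀ {i j : Fin (r + r)} → PathAdj i j → CartesianPath _≢_ (ladder i) (ladder j)
  ladder-adj (inj₁ e) = ladder-step e
  ladder-adj (inj₂ e) = CartesianPath-sym {_∼_ = _≢_} ≢-sym (ladder-step e)

  snake : ∀ {m} → QVertex m × Fin (r + r) → QVertex (suc m) × Fin r
  snake (v , i) = proj₁ (ladder i) ∷ v , proj₂ (ladder i)

  snake↔ : ∀ {m} → (QVertex m × Fin (r + r)) ↔ (QVertex (suc m) × Fin r)
  snake↔ {m} = mk↔ₛ′ snake unsnake snake-unsnake unsnake-snake
    where
      unsnake : QVertex (suc m) × Fin r → QVertex m × Fin (r + r)
      unsnake (b ∷ v , a) = v , unladder (b , a)

      snake-unsnake : ∀ w → snake (unsnake w) ≡ w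
      snake-unsnake (b ∷ v , a) rewrite Inverse.strictlyInverseˡ ladder↔ (b , a) = refl

      unsnake-snake : ∀ x → unsnake (snake x) ≡ x
      unsnake-snake (v , i) = cong (v ,_) (Inverse.strictlyInverseʳ ladder↔ i)

  snake-adj : ∀ {m} {x y : QVertex m × Fin (r + r)} → CartesianPath QAdj x y →
              CartesianPath QAdj (snake x) (snake y)
  snake-adj {x = _ , i} {_ , _} (inj₁ (q , refl)) = inj₁ (QAdj-∷ (proj₁ (ladder i)) q , refl)
  snake-adj {m} {v , i} {_ , j} (inj₂ (refl , p)) = onCube (ladder i) (ladder j) (ladder-adj p)
    where
      onCube : ∀ (x y : Bool × Fin r) → CartesianPath _≢_ x y →
               CartesianPath QAdj (proj₁ x ∷ v , proj₂ x) (proj₁ y ∷ v , proj₂ y)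
      onCube (_ , _) (_ , _) (inj₁ (b≢b′ , e)) = inj₁ (QAdj-head v b≢b′ , e)
      onCube (_ , _) (_ , _) (inj₂ (refl , p)) = inj₂ (refl , p)

module _ {V : Set} where

  concat : ∀ {m n} → (V × Fin m) ⊎ (V × Fin n) → V × Fin (m + n)
  concat {n = n} (inj₁ (v , a)) = v , a ↑ˡ n
  concat {m = m} (inj₂ (v , b)) = v , m ↑ʳ b

  concat↔ : ∀ {m n} → ((V × Fin m) ⊎ (V × Fin n)) ↔ (V × Fin (m + n))
  concat↔ {m} {n} = mk↔ₛ′ concat unconcat concat-unconcat unconcat-concat
    where
      unconcat : V × Fin (m + n) → (V × Fin m) ⊎ (V × Fin n)
      unconcat (v , i) = Sum.map (v ,_) (v ,_) (splitAt m i)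

      concat-unconcat : ∀ x → concat (unconcat x) ≡ x
      concat-unconcat (v , i) with splitAt m i in eq
      ... | inj₁ a = cong (v ,_) (splitAt⁻¹-↑ˡ eq)
      ... | inj₂ b = cong (v ,_) (splitAt⁻¹-↑ʳ eq)

      unconcat-concat : ∀ x → unconcat (concat x) ≡ x
      unconcat-concat (inj₁ (v , a)) rewrite splitAt-↑ˡ m a n = refl
      unconcat-concat (inj₂ (v , b)) rewrite splitAt-↑ʳ m n b = refl

  concat-adj : ∀ {_∼_ : V → V → Set} {m n} {x y : (V × Fin m) ⊎ (V × Fin n)} →
               Pointwise (CartesianPath _∼_) (CartesianPath _∼_) x y → CartesianPath _∼_ (concat x) (concat y)
  concat-adj {x = inj₁ (_ , _)} {inj₁ (_ , _)} (inj₁ (inj₁ (v∼w , refl))) = inj₁ (v∼w , refl)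
  concat-adj {n = n} {inj₁ (_ , _)} {inj₁ (_ , _)} (inj₁ (inj₂ (refl , p))) = inj₂ (refl , PathAdj-↑ˡ n p)
  concat-adj {x = inj₂ (_ , _)} {inj₂ (_ , _)} (inj₂ (inj₁ (v∼w , refl))) = inj₁ (v∼w , refl)
  concat-adj {m = m} {x = inj₂ (_ , _)} {inj₂ (_ , _)} (inj₂ (inj₂ (refl , p))) = inj₂ (refl , PathAdj-↑ʳ m p)

  single↔ : (V × Fin 1) ↔ V
  single↔ = mk↔ₛ′ proj₁ (_, zero) (λ _ → refl) (λ { (_ , zero) → refl })

  single-adj : ∀ {_∼_ : V → V → Set} {x y : V × Fin 1} → CartesianPath _∼_ x y → proj₁ x ∼ proj₁ y
  single-adj {x = _ , _} {_ , _} (inj₁ (v∼w , _)) = v∼w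
  single-adj {x = _ , zero} {_ , zero} (inj₂ (_ , inj₁ ()))
  single-adj {x = _ , zero} {_ , zero} (inj₂ (_ , inj₂ ()))

open +-*-Solver

module DimensionStep {l s : ℕ} (1≤l : 1 ≤ l) (f : ℕ → ℕ) (f-mono : ∀ {m n} → m ≤ n → f m ≤ f n)
                     (tiling : ∀ m → GridTiling l s (QVertex m) QAdj (f m)) where

  PathTiling : ℕ → ℕ → ℕ → Set
  PathTiling m r = GridTiling l (suc s) (QVertex m × Fin r) (CartesianPath QAdj)

  split-bound : ∀ m → f m * l + (l + l * m * f m) ≡ l + l * suc m * f m
  split-bound m = solve 3 (λ L M F → F :* L :+ (L :+ L :* M :* F) := L :+ L :* (con 1 :+ M) :* F) refl l m (f m)

  pathTiling<l : ∀ m r → r < l → PathTiling m r (l + l * m * f m)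
  pathTiling<2l : ∀ m r → r < l + l → PathTiling m r (l + l * suc m * f m)

  pathTiling<l zero r r<l =
    weaken (≤-trans (<⇒≤ r<l) (m≤m+n l _))
           (allLeftovers (mk↔ₛ′ ([] ,_) proj₂ (λ { ([] , _) → refl }) (λ _ → refl)))
  pathTiling<l (suc m) r r<l =
    weaken (+-monoʳ-≤ l (*-monoʳ-≤ (l * suc m) (f-mono (n≤1+n m))))
           (transfer snake↔ snake-adj (pathTiling<2l m (r + r) (+-mono-< r<l r<l)))

  pathTiling<2l m r r<2l with r <? l
  ... | yes r<l = weaken (+-monoʳ-≤ l (*-monoˡ-≤ (f m) (*-monoʳ-≤ l (n≤1+n m)))) (pathTiling<l m r r<l)
  ... | no r≮l with m≤n⇒∃[o]m+o≡n (≮⇒≥ r≮l)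
  ...   | r′ , refl =
    weaken (≤-reflexive (split-bound m))
           (transfer concat↔ (concat-adj {_∼_ = QAdj})
                     (×-path-tiling (tiling m) ⊎-tiling pathTiling<l m r′ (+-cancelˡ-< l r′ l r<2l)))

  tiling-suc : ∀ m → GridTiling l (suc s) (QVertex m) QAdj (l + l * suc m * f m)
  tiling-suc m = transfer single↔ (single-adj {_∼_ = QAdj}) (pathTiling<2l m 1 (+-mono-≤ 1≤l 1≤l))

cubeTiling : ∀ {l} s → 1 ≤ l → Σ ℕ λ c → ∀ m → GridTiling l (suc s) (QVertex m) QAdj (c * suc m ^ s)
cubeTiling {l} zero 1≤l = l , λ m → weaken (≤-reflexive (bound m)) (tiling-suc m)
  where
    open DimensionStep 1≤l (λ _ → 0) (λ _ → z≤n) (λ m → pointTiling (cube↔ m))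
    bound : ∀ m → l + l * suc m * 0 ≡ l * 1
    bound m = solve 2 (λ L M → L :+ L :* M :* con 0 := L :* con 1) refl l (suc m)
cubeTiling {l} (suc s) 1≤l with cubeTiling s 1≤l
... | c , tiling = l + l * c , λ m → weaken (bound m) (tiling-suc m)
  where
    f : ℕ → ℕ
    f m = c * suc m ^ s

    f-mono : ∀ {m n} → m ≤ n → f m ≤ f n
    f-mono m≤n = *-monoʳ-≤ c (^-monoˡ-≤ s (s≤s m≤n))

    open DimensionStep 1≤l f f-mono tiling

    bound : ∀ m → l + l * suc m * f m ≤ (l + l * c) * suc m ^ suc s
    bound m = begin
      l + l * suc m * (c * suc m ^ s)  ≡⟨ solve 4 (λ L M C P → L :+ L :* M :* (C :* P) := L :+ L :* C :* (M :* P))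
                                                refl l (suc m) c (suc m ^ s) ⟩
      l + l * c * Q                    ≤⟨ +-monoˡ-≤ (l * c * Q) (m≤m*n l Q {{m^n≢0 (suc m) (suc s)}}) ⟩
      l * Q + l * c * Q                ≡⟨ sym (*-distribʳ-+ Q l (l * c)) ⟩
      (l + l * c) * Q                  ∎
      where
        open ≤-Reasoning
        Q = suc m ^ suc s

suc-^-≤ : ∀ {n} s → 1 ≤ n → suc n ^ s ≤ 2 ^ s * n ^ s
suc-^-≤ zero    _   = ≤-refl
suc-^-≤ {n} (suc s) 1≤n = begin
  suc n * suc n ^ s         ≤⟨ *-mono-≤ (+-monoˡ-≤ n 1≤n) (suc-^-≤ s 1≤n) ⟩
  (n + n) * (2 ^ s * n ^ s) ≡⟨ solve 3 (λ N T P → (N :+ N) :* (T :* P) := (con 2 :* T) :* (N :* P))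
                                       refl n (2 ^ s) (n ^ s) ⟩
  2 * 2 ^ s * (n * n ^ s)   ∎
  where open ≤-Reasoning

isPathEdge : ∀ {l} → Fin l → Fin l → Bool
isPathEdge x y = (suc (toℕ x) ≡ᵇ toℕ y) ∨ (suc (toℕ y) ≡ᵇ toℕ x)

isPathEdge-sound : ∀ {l} {x y : Fin l} → isPathEdge x y ≡ true → PathAdj x y
isPathEdge-sound e = Sum.map (≡ᵇ⇒≡ _ _) (≡ᵇ⇒≡ _ _) (Equivalence.to T-∨ (Equivalence.from T-≡ e))

pathGraph : ∀ {l} → Graph l
pathGraph = record
  { adj     = isPathEdge
  ; adj-sym = λ x y → ∨-comm (suc (toℕ x) ≡ᵇ toℕ y) _
  ; irrefl  = λ x → [ 1+n≢n , 1+n≢n ]′ ∘ isPathEdge-sound {x = x} {x}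
  }

pathGraph-hamiltonian : ∀ {l} → HasHamPath (pathGraph {l})
pathGraph-hamiltonian = id , id , λ i i+1<l →
  let i<l = <-trans (n<1+n i) i+1<l in
  Equivalence.to T-≡ (Equivalence.from T-∨ (inj₁
    (≡⇒≡ᵇ _ _ (trans (cong suc (toℕ-fromℕ< i<l)) (sym (toℕ-fromℕ< i+1<l))))))

lookup-≗⇒≡ : ∀ {A : Set} {n} (xs ys : Vec A n) → (∀ k → lookup xs k ≡ lookup ys k) → xs ≡ ys
lookup-≗⇒≡ xs ys xs≗ys = trans (sym (tabulate∘lookup xs)) (trans (tabulate-cong xs≗ys) (tabulate∘lookup ys))

pathPower-adj : ∀ {l t} (x y : Grid l t) → ProdAdj (replicate t pathGraph) x y → GridAdj x y
pathPower-adj (x ∷ xs) (y ∷ ys) (zero , e , agree)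
  rewrite lookup-≗⇒≡ xs ys (λ k → agree (suc k) (λ ())) = here (isPathEdge-sound e)
pathPower-adj (x ∷ xs) (y ∷ ys) (suc j , e , agree)
  rewrite agree zero (λ ()) =
    there (pathPower-adj xs ys (j , e , λ k k≢j → agree (suc k) (k≢j ∘ Fin.suc-injective)))

module _ {l t n b} (T : GridTiling l t (QVertex n) QAdj b) where
  open GridTiling T

  piece : Fin copies → Piece n l t
  piece i = record
    { factors = replicate t pathGraph
    ; ham     = λ j → subst HasHamPath (sym (lookup-replicate j pathGraph)) pathGraph-hamiltonian
    ; emb     = copy i
    ; emb-inj = cong proj₂ ∘ copy-injective
    ; emb-hom = λ x y → copy-hom i ∘ pathPower-adj x y
    }

  pieces : List (Piece n l t)
  pieces = tabulate piece

  index : Fin (length pieces) → Fin copies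
  index = cast (length-tabulate piece)

  lookup-pieces : ∀ i → List.lookup pieces i ≡ piece (index i)
  lookup-pieces i = trans (cong (List.lookup pieces) (sym (cast-involutive _ (length-tabulate piece) i)))
                          (lookup-tabulate piece (index i))

  pieces-disjoint : PairwiseDisjoint pieces
  pieces-disjoint i j i≢j x y e = i≢j (toℕ-injective (begin
    toℕ i         ≡⟨ sym (toℕ-cast _ i) ⟩
    toℕ (index i) ≡⟨ cong (toℕ ∘ proj₁) (copy-injective copies-meet) ⟩
    toℕ (index j) ≡⟨ toℕ-cast _ j ⟩
    toℕ j         ∎))
    where
      open ≡-Reasoning
      copies-meet : copy (index i) x ≡ copy (index j) y
      copies-meet = subst₂ (λ P Q → Piece.emb P x ≡ Piece.emb Q y) (lookup-pieces i) (lookup-pieces j) e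

  pieces-cover : CoversAllBut pieces b
  pieces-cover = tabulate leftover , subst (_≤ b) (sym (length-tabulate leftover)) leftovers≤ , cover
    where
      cover : ∀ v → Covered pieces v ⊎ v ∈ tabulate leftover
      cover v with locate v | place-locate v
      ... | inj₁ (i , x) | e = inj₁ (cast (sym (length-tabulate piece)) i , x ,
                                     trans (cong (λ P → Piece.emb P x) (lookup-tabulate piece i)) e)
      ... | inj₂ a       | e = inj₂ (subst (_∈ tabulate leftover) e (∈-tabulate⁺ a))

corollary10 : (l t : ℕ) → 1 ≤ l → 1 ≤ t →
    Σ ℕ λ C → Σ ℕ λ n₀ → (n : ℕ) → n₀ ≤ n →
      Σ (List (Piece n l t)) λ ps →
        PairwiseDisjoint ps × CoversAllBut ps (C * n ^ (t ∸ 1))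
corollary10 l (suc s) 1≤l (s≤s z≤n) with cubeTiling s 1≤l
... | c , tiling = c * 2 ^ s , 1 , λ n 1≤n →
  let T = weaken (≤-trans (*-monoʳ-≤ c (suc-^-≤ s 1≤n)) (≤-reflexive (sym (*-assoc c _ _)))) (tiling n)
  in pieces T , pieces-disjoint T , pieces-cover T
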